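{- Let $m,n$ be odd integers with $3\le m\le n$. If the derived multicycle $\hat B_{m,n}$ has a proper edge-coloring using at most $n-1$ colors, then the queen graph $Q_{m,n}$ satisfies $\chi'(Q_{m,n})=3m+n-4$ (so $Q_{m,n}$ is class 1).
   Context: The bishop graph $B_{m,n}$ has vertex set $\{(x,y): 1\le x\le n,\ 1\le y\le m\}$ (column $x$, row $y$), with $(x_1,y_1)$ adjacent to $(x_2,y_2)$ iff $|x_1-x_2|=|y_1-y_2|\ge 1$; such an edge has length $|x_1-x_2|$ and positive slope if $(x_1-x_2)(y_1-y_2)>0$, negative slope otherwise. Write $m=2k+1$. For $1\le i\le k$, $G_i^+$ is the spanning subgraph of all edges of negative slope and length $i$ and of positive slope and length $m-i$; $G_i^-$ is that of all edges of positive slope and length $i$ and of negative slope and length $m-i$. These $2k$ subgraphs partition the edges, and each is a vertex-disjoint union of paths moving strictly rightward, so each path has a leftmost edge. The canonical coloring of $B_{m,n}$ gives the $2k$ subgraphs disjoint ordered pairs of colors from $\{1,\dots,2m-2\}$, $G_k^-$ getting the pair $(2m-3,2m-2)$, and colors each path alternately with its subgraph's two colors, the first color on the leftmost edge. The derived multicycle $\hat B_{m,n}$ is the multigraph on vertex set $\{1,\dots,m\}$ (the rows) having, for each edge $(x_1,y_1)(x_2,y_2)$ of $B_{m,n}$ that receives color $2m-2$ in the canonical coloring, one edge joining $y_1$ and $y_2$ (parallel edges allowed). The queen graph $Q_{m,n}$ has the cells of an $m\times n$ grid as vertices, two cells adjacent iff they share a row, column, diagonal or anti-diagonal; $\chi'$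 denotes edge-chromatic number, and for odd $m<n$, $\Delta(Q_{m,n})=3m+n-4$. -}

module Defs where

open import Data.Nat using (ℕ; zero; suc; _+_; _*_; _∸_; _≤_; _<_)
open import Data.Nat.DivMod using (_/_; _%_)
open import Data.Fin using (Fin)
open import Data.Product using (Σ; _×_; _,_; proj₁; proj₂)
open import Data.Sum using (_⊎_)
open import Relation.Binary.PropositionalEquality using (_≡_; _≢_)
open import Relation.Nullary using (¬_)

Even : ℕ → Set
Even p = p % 2 ≡ 0

Odd : ℕ → Set
Odd p = p % 2 ≡ 1

-- Cells (x , y): column x, row y, 1-based.
Cell : Set
Cell = ℕ × ℕ

col : Cell → ℕ
col = proj₁

row : Cell → ℕ
row = proj₂

OnBoard : ℕ → ℕ → Cell → Set
OnBoard m n (x , y) = (1 ≤ x × x ≤ n) × (1 ≤ y × y ≤ m)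

PosEdge : ℕ → Cell → Cell → Set
PosEdge i (x₁ , y₁) (x₂ , y₂) = (x₂ ≡ x₁ + i) × (y₂ ≡ y₁ + i)

NegEdge : ℕ → Cell → Cell → Set
NegEdge i (x₁ , y₁) (x₂ , y₂) = (x₂ ≡ x₁ + i) × (y₁ ≡ y₂ + i)

-- k where m = 2k+1
half : ℕ → ℕ
half m = m / 2

-- u → v (u left, v right) is an edge of G_k^- in B_{m,n}, k = (m-1)/2:
-- positive slope and length k, or negative slope and length m - k.
GkMinus : ℕ → ℕ → Cell → Cell → Set
GkMinus m n u v =
  OnBoard m n u × OnBoard m n v ×
  (PosEdge (half m) u v ⊎ NegEdge (m ∸ half m) u v)

data PathPos (m n : ℕ) : Cell → Cell → ℕ → Set where
  leftmost : ∀ {u v} → GkMinus m n u v →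
             (∀ w → ¬ GkMinus m n w u) → PathPos m n u v 1
  following : ∀ {w u v p} → GkMinus m n u v →
              PathPos m n w u p → PathPos m n u v (suc p)

-- The edge u → v of B_{m,n} receives colour 2m-2 in the canonical
-- coloring: it lies in G_k^- (pair (2m-3, 2m-2)) at an even position
-- of its path (colours alternate starting with 2m-3 on the leftmost edge).
HatEdge : ℕ → ℕ → Cell → Cell → Set
HatEdge m n u v = Σ ℕ λ p → PathPos m n u v p × Even p

-- Two edges of the derived multicycle (indexed by the underlying bishop
-- edges u → v and u' → v', joining rows row u, row v and row u', row v')
-- share an endpoint.
ShareRow : Cell → Cell → Cell → Cell → Set
ShareRow u v u' v' =
  (row u ≡ row u' ⊎ row u ≡ row v') ⊎ (row v ≡ row u' ⊎ row v ≡ row v')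

HatProperColoring : ℕ → ℕ → ℕ → Set
HatProperColoring m n c =
  Σ ((u v : Cell) → HatEdge m n u v → Fin c) λ col →
    ∀ u v u' v' (e : HatEdge m n u v) (e' : HatEdge m n u' v') →
      ¬ (u ≡ u' × v ≡ v') → ShareRow u v u' v' → col u v e ≢ col u' v' e'

QAdj : ℕ → ℕ → Cell → Cell → Set
QAdj m n (x₁ , y₁) (x₂ , y₂) =
  OnBoard m n (x₁ , y₁) × OnBoard m n (x₂ , y₂) × ((x₁ , y₁) ≢ (x₂ , y₂)) ×
  ((y₁ ≡ y₂ ⊎ x₁ ≡ x₂) ⊎ (x₁ + y₂ ≡ x₂ + y₁ ⊎ x₁ + y₁ ≡ x₂ + y₂))

QEdgeColorable : ℕ → ℕ → ℕ → Set
QEdgeColorable m n c =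
  Σ ((u v : Cell) → QAdj m n u v → Fin c) λ col →
    (∀ u v (p : QAdj m n u v) (q : QAdj m n v u) → col u v p ≡ col v u q) ×
    (∀ u v w (p : QAdj m n u v) (q : QAdj m n u w) → col u v p ≡ col u w q → v ≡ w)

QChromaticIndex : ℕ → ℕ → ℕ → Set
QChromaticIndex m n c =
  QEdgeColorable m n c × (∀ d → QEdgeColorable m n d → c ≤ d)

-- Any proper edge colouring needs 3m + n - 4 colours at the centre cell, which has that many
-- neighbours.  Conversely, colour the bishop edges canonically and take their colour 2m - 2 away:
-- its edges, the edges of \hat B_{m,n}, get the n - 1 colours of the given colouring instead.
-- Colour each column as K_m and each row as K_n by (a + b) / 2 modulo m resp. n, which leaves
-- colour a missing at the a-th cell.  The hat edges at the cells of one row all meet that row in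
-- \hat B_{m,n}, so their colours are distinct, and the n row colours of row y can be renamed
-- injectively into those n - 1 colours and the column colour missing at row y, turning the colour
-- missing at each cell into the colour of its hat edge.  This uses 2m - 3 + m + (n - 1) colours.
module Submission where

open import Defs

open import Data.Empty using (⊥; ⊥-elim)
open import Data.Fin using (Fin; toℕ; fromℕ<; splitAt; _↑ˡ_; _↑ʳ_)
import Data.Fin.Properties as Finₚ
open import Data.Maybe using (Maybe; just; nothing)
import Data.Maybe as Maybe
open import Data.Maybe.Properties using (just-injective)
open import Data.Nat
open import Data.Nat.DivMod
open import Data.Nat.Properties
open import Data.Nat.Tactic.RingSolver using (solve-∀)
open import Data.Product using (Σ; ∃₂; _×_; _,_; proj₁; proj₂)
open import Data.Product.Properties using (≡-dec)
open import Data.Sum using (_⊎_; inj₁; inj₂)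
import Data.Sum as Sum
open import Data.Vec.Functional using (Vector; _++_)
open import Data.Vec.Functional.Relation.Unary.All using (All)
open import Function using (_∘_)
open import Function.Definitions using (Injective)
open import Relation.Binary using (tri<; tri≈; tri>)
open import Relation.Binary.PropositionalEquality
open import Relation.Nullary using (¬_; Dec; yes; no)
open import Relation.Nullary.Decidable using (_×-dec_)

Congruent : ℕ → ℕ → ℕ → Set
Congruent N x y = ∃₂ λ p q → x + p * N ≡ y + q * N

congruent-sym : ∀ {N x y} → Congruent N x y → Congruent N y x
congruent-sym (p , q , e) = q , p , sym e

congruent-trans : ∀ {N x y z} → Congruent N x y → Congruent N y z → Congruent N x z
congruent-trans {N} {x} {y} {z} (p , q , e) (p' , q' , e') = p + p' , q' + q , (begin
  x + (p + p') * N       ≡⟨ shift x p p' N ⟩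
  (x + p * N) + p' * N   ≡⟨ cong (_+ p' * N) e ⟩
  (y + q * N) + p' * N   ≡⟨ swap y q p' N ⟩
  (y + p' * N) + q * N   ≡⟨ cong (_+ q * N) e' ⟩
  (z + q' * N) + q * N   ≡⟨ sym (shift z q' q N) ⟩
  z + (q' + q) * N       ∎)
  where
  open ≡-Reasoning
  shift : ∀ x p p' N → x + (p + p') * N ≡ (x + p * N) + p' * N
  shift = solve-∀
  swap : ∀ y q p' N → (y + q * N) + p' * N ≡ (y + p' * N) + q * N
  swap = solve-∀

congruent-cancelˡ : ∀ {N} a {x y} → Congruent N (a + x) (a + y) → Congruent N x y
congruent-cancelˡ a {x} {y} (p , q , e) =
  p , q , +-cancelˡ-≡ a _ _ (trans (sym (+-assoc a x _)) (trans e (+-assoc a y _)))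

congruent⇒≡ : ∀ {N} .{{_ : NonZero N}} {x y} → x < N → y < N → Congruent N x y → x ≡ y
congruent⇒≡ {N} {x} {y} x<N y<N (p , q , e) = begin
  x               ≡⟨ m<n⇒m%n≡m x<N ⟨
  x % N           ≡⟨ [m+kn]%n≡m%n x p N ⟨
  (x + p * N) % N ≡⟨ cong (_% N) e ⟩
  (y + q * N) % N ≡⟨ [m+kn]%n≡m%n y q N ⟩
  y % N           ≡⟨ m<n⇒m%n≡m y<N ⟩
  y               ∎
  where open ≡-Reasoning

digits-injective : ∀ {b r r' a a'} .{{_ : NonZero b}} → r < b → r' < b →
                   r + a * b ≡ r' + a' * b → r ≡ r' × a ≡ a'
digits-injective {b} {r} {r'} {a} {a'} r<b r'<b e =
  r≡r' , *-cancelʳ-≡ a a' b (+-cancelˡ-≡ r _ _ (trans e (cong (_+ a' * b) (sym r≡r'))))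
  where
  r≡r' : r ≡ r'
  r≡r' = congruent⇒≡ r<b r'<b (a , a' , e)

-- Since 2 (t + 1) = N + 1, the colour of {a, b} is (a + b) / 2 modulo N: a proper
-- N-colouring of the complete graph on 0 … N - 1 in which vertex a misses colour a.
module OddComplete (t : ℕ) where

  N : ℕ
  N = suc (t + t)

  edgeColour : ℕ → ℕ → ℕ
  edgeColour a b = ((a + b) * suc t) % N

  edgeColour-comm : ∀ a b → edgeColour a b ≡ edgeColour b a
  edgeColour-comm a b = cong (λ s → (s * suc t) % N) (+-comm a b)

  edgeColour-< : ∀ a b → edgeColour a b < N
  edgeColour-< a b = m%n<n ((a + b) * suc t) N

  edgeColour-double : ∀ a b → Congruent N (edgeColour a b + edgeColour a b) (a + b)
  edgeColour-double a b = s / N + s / N , a + b , (begin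
    c + c + (s / N + s / N) * N       ≡⟨ regroup c (s / N) N ⟩
    (c + s / N * N) + (c + s / N * N) ≡⟨ cong₂ _+_ (sym (m≡m%n+[m/n]*n s N)) (sym (m≡m%n+[m/n]*n s N)) ⟩
    s + s                             ≡⟨ double (a + b) t ⟩
    a + b + (a + b) * N               ∎)
    where
    open ≡-Reasoning
    s c : ℕ
    s = (a + b) * suc t
    c = edgeColour a b
    regroup : ∀ c q N → c + c + (q + q) * N ≡ (c + q * N) + (c + q * N)
    regroup = solve-∀
    double : ∀ s t → s * suc t + s * suc t ≡ s + s * suc (t + t)
    double = solve-∀

  edgeColour-injectiveʳ : ∀ a {b b'} → b < N → b' < N → edgeColour a b ≡ edgeColour a b' → b ≡ b'
  edgeColour-injectiveʳ a {b} {b'} b<N b'<N e = congruent⇒≡ b<N b'<N (congruent-cancelˡ a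
    (congruent-trans (congruent-sym (edgeColour-double a b))
      (subst (λ c → Congruent N (c + c) (a + b')) (sym e) (edgeColour-double a b'))))

  edgeColour-missing : ∀ {a b} → a < N → b < N → edgeColour a b ≡ a → a ≡ b
  edgeColour-missing {a} {b} a<N b<N e = congruent⇒≡ a<N b<N (congruent-cancelˡ a
    (subst (λ c → Congruent N (c + c) (a + b)) e (edgeColour-double a b)))

transpose : ℕ → ℕ → ℕ → ℕ
transpose a b z with z ≟ a
... | yes _ = b
... | no _ with z ≟ b
...   | yes _ = a
...   | no _ = z

transpose-left : ∀ a b → transpose a b a ≡ b
transpose-left a b with a ≟ a
... | yes _ = refl
... | no a≢a = ⊥-elim (a≢a refl)

transpose-fixed : ∀ {a b z} → z ≢ a → z ≢ b → transpose a b z ≡ z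
transpose-fixed {a} {b} {z} z≢a z≢b with z ≟ a
... | yes z≡a = ⊥-elim (z≢a z≡a)
... | no _ with z ≟ b
...   | yes z≡b = ⊥-elim (z≢b z≡b)
...   | no _ = refl

transpose-< : ∀ {n a b} z → a < n → b < n → z < n → transpose a b z < n
transpose-< {a = a} {b} z a<n b<n z<n with z ≟ a
... | yes _ = b<n
... | no _ with z ≟ b
...   | yes _ = a<n
...   | no _ = z<n

transpose-right : ∀ a b → transpose a b b ≡ a
transpose-right a b with b ≟ a
... | yes b≡a = b≡a
... | no _ with b ≟ b
...   | yes _ = refl
...   | no b≢b = ⊥-elim (b≢b refl)

transpose-involutive : ∀ a b z → transpose a b (transpose a b z) ≡ z
transpose-involutive a b z with z ≟ a
... | yes refl = transpose-right z b
... | no z≢a with z ≟ b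
...   | yes refl = transpose-left a z
...   | no z≢b = transpose-fixed z≢a z≢b

transpose-injective : ∀ a b {z z'} → transpose a b z ≡ transpose a b z' → z ≡ z'
transpose-injective a b {z} {z'} e = begin
  z                                 ≡⟨ transpose-involutive a b z ⟨
  transpose a b (transpose a b z)   ≡⟨ cong (transpose a b) e ⟩
  transpose a b (transpose a b z')  ≡⟨ transpose-involutive a b z' ⟩
  z'                                ∎
  where open ≡-Reasoning

module Extension (target : ℕ → Maybe ℕ) where

  extend : ℕ → ℕ → ℕ
  extend zero z = z
  extend (suc j) z with target j
  ... | just t = transpose (extend j j) t (extend j z)
  ... | nothing = extend j z

  extend-injective : ∀ j {z z'} → extend j z ≡ extend j z' → z ≡ z'
  extend-injective zero e = e
  extend-injective (suc j) e with target j
  ... | just t = extend-injective j (transpose-injective _ t e)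
  ... | nothing = extend-injective j e

  extend-< : ∀ {n} → (∀ {a t} → target a ≡ just t → t < n) →
             ∀ {j} → j ≤ n → ∀ {z} → z < n → extend j z < n
  extend-< bounded {zero} j≤n z<n = z<n
  extend-< bounded {suc j} j<n z<n with target j in eq
  ... | just t = transpose-< _ (extend-< bounded (<⇒≤ j<n) j<n) (bounded eq) (extend-< bounded (<⇒≤ j<n) z<n)
  ... | nothing = extend-< bounded (<⇒≤ j<n) z<n

  extend-target : (∀ {a a' t} → target a ≡ just t → target a' ≡ just t → a ≡ a') →
                  ∀ {j a t} → a < j → target a ≡ just t → extend j a ≡ t
  extend-target injective {suc j} {a} a<1+j ea with target j in eq | a ≟ j
  ... | just t' | yes refl with trans (sym ea) eq
  ...   | refl = transpose-left (extend j j) t'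
  extend-target injective {suc j} {a} {t} a<1+j ea | just t' | no a≢j =
    trans (cong (transpose (extend j j) t') previous)
          (transpose-fixed (λ e → a≢j (extend-injective j (trans previous e)))
                           (λ e → a≢j (injective ea (subst (λ s → target j ≡ just s) (sym e) eq))))
    where
    previous : extend j a ≡ t
    previous = extend-target injective (≤∧≢⇒< (s≤s⁻¹ a<1+j) a≢j) ea
  extend-target injective {suc j} a<1+j ea | nothing | yes refl with trans (sym ea) eq
  ... | ()
  extend-target injective {suc j} a<1+j ea | nothing | no a≢j =
    extend-target injective (≤∧≢⇒< (s≤s⁻¹ a<1+j) a≢j) ea

odd⇒suc-even : ∀ {d} → Odd d → Even (suc d)
odd⇒suc-even {suc zero} _ = refl
odd⇒suc-even {suc (suc d)} o = odd⇒suc-even {d} o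

parity-suc≢ : ∀ d → suc d % 2 ≢ d % 2
parity-suc≢ (suc zero) ()
parity-suc≢ (suc (suc d)) e = parity-suc≢ d e

odd? : ∀ d → Dec (Odd d)
odd? d = d % 2 ≟ 1

onBoard-irrelevant : ∀ {m n u} (a b : OnBoard m n u) → a ≡ b
onBoard-irrelevant ((a₁ , a₂) , (a₃ , a₄)) ((b₁ , b₂) , (b₃ , b₄)) =
  cong₂ _,_ (cong₂ _,_ (≤-irrelevant a₁ b₁) (≤-irrelevant a₂ b₂))
            (cong₂ _,_ (≤-irrelevant a₃ b₃) (≤-irrelevant a₄ b₄))

-- For i = half m, Edge is GkMinus.  A path enters (x , y) from (x - i , y - i) if y > i and
-- from (x - (m - i) , y + (m - i)) otherwise, so depth, the number of edges before (x , y) on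
-- its path, needs at most x recursive calls.
module Paths (m n i : ℕ) where

  j : ℕ
  j = m ∸ i

  Edge : Cell → Cell → Set
  Edge u v = OnBoard m n u × OnBoard m n v × (PosEdge i u v ⊎ NegEdge j u v)

  depthWithin : ℕ → Cell → ℕ
  depthWithin zero _ = 0
  depthWithin (suc f) (x , y) with i <? y
  ... | yes _ with i <? x
  ...   | yes _ = suc (depthWithin f (x ∸ i , y ∸ i))
  ...   | no _ = 0
  depthWithin (suc f) (x , y) | no _ with j <? x
  ...   | yes _ = suc (depthWithin f (x ∸ j , y + j))
  ...   | no _ = 0

  depth : Cell → ℕ
  depth u = depthWithin (col u) u

  Joined : ℕ → Cell → Cell → Set
  Joined p u v = (Edge u v × depth u % 2 ≡ p) ⊎ (Edge v u × depth v % 2 ≡ p)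

  joined-parity-< : ∀ {p u v} → Joined p u v → p < 2
  joined-parity-< {u = u} (inj₁ (_ , refl)) = m%n<n (depth u) 2
  joined-parity-< {v = v} (inj₂ (_ , refl)) = m%n<n (depth v) 2

module PathProperties (m n i : ℕ) (1≤i : 1 ≤ i) (i<m : i < m) where

  open Paths m n i public

  1≤j : 1 ≤ j
  1≤j = m<n⇒0<n∸m i<m

  i+j≡m : i + j ≡ m
  i+j≡m = m+[n∸m]≡n (<⇒≤ i<m)

  j+i≡m : j + i ≡ m
  j+i≡m = trans (+-comm j i) i+j≡m

  overflow : ∀ {a b y} → a + b ≡ m → a < y → y + b ≤ m → ⊥
  overflow {a} {b} {y} a+b≡m a<y = <⇒≱ (subst (_< y + b) a+b≡m (+-monoˡ-< b a<y))

  slopes-exclusive : ∀ {y y'} → y' ≡ y + i → y ≡ y' + j → ⊥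
  slopes-exclusive {y} refl e = <⇒≢ (≤-trans (m<m+n y 1≤i) (m≤m+n (y + i) j)) e

  edge-irrelevant : ∀ {u v} (a b : Edge u v) → a ≡ b
  edge-irrelevant (a₁ , a₂ , inj₁ (p , q)) (b₁ , b₂ , inj₁ (p' , q'))
    rewrite onBoard-irrelevant a₁ b₁ | onBoard-irrelevant a₂ b₂ | ≡-irrelevant p p' | ≡-irrelevant q q' = refl
  edge-irrelevant (a₁ , a₂ , inj₂ (p , q)) (b₁ , b₂ , inj₂ (p' , q'))
    rewrite onBoard-irrelevant a₁ b₁ | onBoard-irrelevant a₂ b₂ | ≡-irrelevant p p' | ≡-irrelevant q q' = refl
  edge-irrelevant (_ , _ , inj₁ (_ , q)) (_ , _ , inj₂ (_ , q')) = ⊥-elim (slopes-exclusive q q')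
  edge-irrelevant (_ , _ , inj₂ (_ , q)) (_ , _ , inj₁ (_ , q')) = ⊥-elim (slopes-exclusive q' q)

  successor-unique : ∀ {u v v'} → Edge u v → Edge u v' → v ≡ v'
  successor-unique (_ , _ , inj₁ (refl , refl)) (_ , _ , inj₁ (refl , refl)) = refl
  successor-unique {v = _ , y} (_ , _ , inj₂ (refl , refl)) (_ , _ , inj₂ (refl , e)) = cong₂ _,_ refl (+-cancelʳ-≡ j y _ e)
  successor-unique (_ , (_ , (_ , y+i≤m)) , inj₁ (_ , refl)) (_ , (_ , (1≤y' , _)) , inj₂ (_ , refl)) =
    ⊥-elim (overflow j+i≡m (m<n+m j 1≤y') y+i≤m)
  successor-unique (_ , (_ , (1≤y , _)) , inj₂ (_ , refl)) (_ , (_ , (_ , y+i≤m)) , inj₁ (_ , refl)) =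
    ⊥-elim (overflow j+i≡m (m<n+m j 1≤y) y+i≤m)

  predecessor-unique : ∀ {w w' u} → Edge w u → Edge w' u → w ≡ w'
  predecessor-unique {_ , y} {_ , y'} (_ , _ , inj₁ (refl , refl)) (_ , _ , inj₁ (p , q)) =
    cong₂ _,_ (+-cancelʳ-≡ i _ _ p) (+-cancelʳ-≡ i y y' q)
  predecessor-unique (_ , _ , inj₂ (refl , refl)) (_ , _ , inj₂ (p , refl)) = cong₂ _,_ (+-cancelʳ-≡ j _ _ p) refl
  predecessor-unique ((_ , (1≤y , _)) , _ , inj₁ (_ , refl)) ((_ , (_ , y'≤m)) , _ , inj₂ (_ , refl)) =
    ⊥-elim (overflow i+j≡m (m<n+m i 1≤y) y'≤m)
  predecessor-unique ((_ , (_ , y≤m)) , _ , inj₂ (_ , refl)) ((_ , (1≤y' , _)) , _ , inj₁ (_ , refl)) =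
    ⊥-elim (overflow i+j≡m (m<n+m i 1≤y') y≤m)

  edge-col< : ∀ {u v} → Edge u v → col u < col v
  edge-col< {x , _} (_ , _ , inj₁ (refl , _)) = m<m+n x 1≤i
  edge-col< {x , _} (_ , _ , inj₂ (refl , _)) = m<m+n x 1≤j

  edge-row≢ : ∀ {u v} → Edge u v → row u ≢ row v
  edge-row≢ {_ , y} (_ , _ , inj₁ (_ , refl)) = <⇒≢ (m<m+n y 1≤i)
  edge-row≢ {v = _ , y} (_ , _ , inj₂ (_ , refl)) = ≢-sym (<⇒≢ (m<m+n y 1≤j))

  predecessor-pos : ∀ {x y} → OnBoard m n (x , y) → i < y → i < x → Edge (x ∸ i , y ∸ i) (x , y)
  predecessor-pos {x} {y} u∈@((_ , x≤n) , (_ , y≤m)) i<y i<x =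
    ((m<n⇒0<n∸m i<x , ≤-trans (m∸n≤m x i) x≤n) , (m<n⇒0<n∸m i<y , ≤-trans (m∸n≤m y i) y≤m)) , u∈ ,
    inj₁ (sym (m∸n+n≡m (<⇒≤ i<x)) , sym (m∸n+n≡m (<⇒≤ i<y)))

  predecessor-neg : ∀ {x y} → OnBoard m n (x , y) → ¬ i < y → j < x → Edge (x ∸ j , y + j) (x , y)
  predecessor-neg {x} {y} u∈@((_ , x≤n) , (1≤y , _)) i≮y j<x =
    ((m<n⇒0<n∸m j<x , ≤-trans (m∸n≤m x j) x≤n) ,
     (≤-trans 1≤y (m≤m+n y j) , subst (y + j ≤_) i+j≡m (+-monoˡ-≤ j (≮⇒≥ i≮y)))) , u∈ ,
    inj₂ (sym (m∸n+n≡m (<⇒≤ j<x)) , refl)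

  predecessor? : ∀ {u} → OnBoard m n u → (Σ Cell λ w → Edge w u) ⊎ (∀ w → ¬ Edge w u)
  predecessor? {x , y} u∈ with i <? y
  ... | yes i<y with i <? x
  ...   | yes i<x = inj₁ (_ , predecessor-pos u∈ i<y i<x)
  ...   | no i≮x = inj₂ none
    where
    none : ∀ w → ¬ Edge w (x , y)
    none _ (((1≤x' , _) , _) , _ , inj₁ (refl , _)) = i≮x (m<n+m i 1≤x')
    none _ ((_ , (_ , y+j≤m)) , _ , inj₂ (_ , refl)) = overflow i+j≡m i<y y+j≤m
  predecessor? {x , y} u∈ | no i≮y with j <? x
  ...   | yes j<x = inj₁ (_ , predecessor-neg u∈ i≮y j<x)
  ...   | no j≮x = inj₂ none
    where
    none : ∀ w → ¬ Edge w (x , y)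
    none _ ((_ , (1≤y' , _)) , _ , inj₁ (_ , refl)) = i≮y (m<n+m i 1≤y')
    none _ (((1≤x' , _) , _) , _ , inj₂ (refl , _)) = j≮x (m<n+m j 1≤x')

  successor? : ∀ {u} → OnBoard m n u → (Σ Cell λ v → Edge u v) ⊎ (∀ v → ¬ Edge u v)
  successor? {x , y} u∈@((1≤x , _) , (1≤y , _)) with j <? y
  ... | no j≮y with x + i ≤? n
  ...   | yes x+i≤n =
    inj₁ (_ , u∈ , ((≤-trans 1≤x (m≤m+n x i) , x+i≤n) , (≤-trans 1≤y (m≤m+n y i) , y+i≤m)) , inj₁ (refl , refl))
    where
    y+i≤m : y + i ≤ m
    y+i≤m = subst (y + i ≤_) j+i≡m (+-monoˡ-≤ i (≮⇒≥ j≮y))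
  ...   | no x+i≰n = inj₂ none
    where
    none : ∀ v → ¬ Edge (x , y) v
    none _ (_ , ((_ , x+i≤n) , _) , inj₁ (refl , _)) = x+i≰n x+i≤n
    none _ (_ , (_ , (1≤y' , _)) , inj₂ (_ , refl)) = j≮y (m<n+m j 1≤y')
  successor? {x , y} u∈@((1≤x , _) , (_ , y≤m)) | yes j<y with x + j ≤? n
  ...   | yes x+j≤n =
    inj₁ (_ , u∈ , ((≤-trans 1≤x (m≤m+n x j) , x+j≤n) , (m<n⇒0<n∸m j<y , ≤-trans (m∸n≤m y j) y≤m)) ,
         inj₂ (refl , sym (m∸n+n≡m (<⇒≤ j<y))))
  ...   | no x+j≰n = inj₂ none
    where
    none : ∀ v → ¬ Edge (x , y) v
    none _ (_ , (_ , (_ , y+i≤m)) , inj₁ (_ , refl)) = overflow j+i≡m j<y y+i≤m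
    none _ (_ , ((_ , x+j≤n) , _) , inj₂ (refl , _)) = x+j≰n x+j≤n

  depthWithin-origin : ∀ f y → depthWithin f (0 , y) ≡ 0
  depthWithin-origin zero y = refl
  depthWithin-origin (suc f) y with i <? y
  ... | yes _ with i <? 0
  ...   | no _ = refl
  depthWithin-origin (suc f) y | no _ with j <? 0
  ...   | no _ = refl

  m≤1+n⇒m∸o≤n : ∀ {x f} k → 1 ≤ k → x ≤ suc f → x ∸ k ≤ f
  m≤1+n⇒m∸o≤n {x} k 1≤k x≤1+f = ≤-trans (∸-monoʳ-≤ x 1≤k) (∸-monoˡ-≤ 1 x≤1+f)

  depthWithin-fuel : ∀ {f g x y} → x ≤ f → x ≤ g → depthWithin f (x , y) ≡ depthWithin g (x , y)
  depthWithin-fuel {zero} {g} {y = y} z≤n _ = sym (depthWithin-origin g y)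
  depthWithin-fuel {suc f} {zero} {y = y} _ z≤n = depthWithin-origin (suc f) y
  depthWithin-fuel {suc f} {suc g} {x} {y} x≤1+f x≤1+g with i <? y
  ... | yes _ with i <? x
  ...   | yes _ = cong suc (depthWithin-fuel (m≤1+n⇒m∸o≤n i 1≤i x≤1+f) (m≤1+n⇒m∸o≤n i 1≤i x≤1+g))
  ...   | no _ = refl
  depthWithin-fuel {suc f} {suc g} {x} {y} x≤1+f x≤1+g | no _ with j <? x
  ...   | yes _ = cong suc (depthWithin-fuel (m≤1+n⇒m∸o≤n j 1≤j x≤1+f) (m≤1+n⇒m∸o≤n j 1≤j x≤1+g))
  ...   | no _ = refl

  depthWithin-pos : ∀ f {x y} → i < y → i < x → depthWithin (suc f) (x , y) ≡ suc (depthWithin f (x ∸ i , y ∸ i))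
  depthWithin-pos f {x} {y} i<y i<x with i <? y
  ... | no i≮y = ⊥-elim (i≮y i<y)
  ... | yes _ with i <? x
  ...   | no i≮x = ⊥-elim (i≮x i<x)
  ...   | yes _ = refl

  depthWithin-neg : ∀ f {x y} → ¬ i < y → j < x → depthWithin (suc f) (x , y) ≡ suc (depthWithin f (x ∸ j , y + j))
  depthWithin-neg f {x} {y} i≮y j<x with i <? y
  ... | yes i<y = ⊥-elim (i≮y i<y)
  ... | no _ with j <? x
  ...   | no j≮x = ⊥-elim (j≮x j<x)
  ...   | yes _ = refl

  depth-unfold : ∀ x y → depth (x , y) ≡ depthWithin (suc x) (x , y)
  depth-unfold x y = depthWithin-fuel ≤-refl (n≤1+n x)

  depth-step : ∀ {w u} → Edge w u → depth u ≡ suc (depth w)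
  depth-step {x , y} (((1≤x , _) , (1≤y , _)) , _ , inj₁ (refl , refl)) = begin
    depth (x + i , y + i)                             ≡⟨ depth-unfold (x + i) (y + i) ⟩
    depthWithin (suc (x + i)) (x + i , y + i)         ≡⟨ depthWithin-pos (x + i) (m<n+m i 1≤y) (m<n+m i 1≤x) ⟩
    suc (depthWithin (x + i) (x + i ∸ i , y + i ∸ i))
      ≡⟨ cong₂ (λ a b → suc (depthWithin (x + i) (a , b))) (m+n∸n≡m x i) (m+n∸n≡m y i) ⟩
    suc (depthWithin (x + i) (x , y))                 ≡⟨ cong suc (depthWithin-fuel (m≤m+n x i) ≤-refl) ⟩
    suc (depth (x , y))                               ∎
    where open ≡-Reasoning
  depth-step {x , _} {_ , y} (((1≤x , _) , (_ , y+j≤m)) , _ , inj₂ (refl , refl)) = begin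
    depth (x + j , y)                          ≡⟨ depth-unfold (x + j) y ⟩
    depthWithin (suc (x + j)) (x + j , y)      ≡⟨ depthWithin-neg (x + j) (λ i<y → overflow i+j≡m i<y y+j≤m) (m<n+m j 1≤x) ⟩
    suc (depthWithin (x + j) (x + j ∸ j , y + j)) ≡⟨ cong (λ a → suc (depthWithin (x + j) (a , y + j))) (m+n∸n≡m x j) ⟩
    suc (depthWithin (x + j) (x , y + j))      ≡⟨ cong suc (depthWithin-fuel (m≤m+n x j) ≤-refl) ⟩
    suc (depth (x , y + j))                    ∎
    where open ≡-Reasoning

  depth-start : ∀ {u} → OnBoard m n u → (∀ w → ¬ Edge w u) → depth u ≡ 0
  depth-start {x , y} u∈ no-predecessor = trans (depth-unfold x y) unfolded
    where
    unfolded : depthWithin (suc x) (x , y) ≡ 0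
    unfolded with i <? y
    ... | yes i<y with i <? x
    ...   | yes i<x = ⊥-elim (no-predecessor _ (predecessor-pos u∈ i<y i<x))
    ...   | no _ = refl
    unfolded | no i≮y with j <? x
    ...   | yes j<x = ⊥-elim (no-predecessor _ (predecessor-neg u∈ i≮y j<x))
    ...   | no _ = refl

  joined-unique : ∀ {p u v w} → Joined p u v → Joined p u w → v ≡ w
  joined-unique (inj₁ (e , _)) (inj₁ (e' , _)) = successor-unique e e'
  joined-unique (inj₂ (e , _)) (inj₂ (e' , _)) = predecessor-unique e e'
  joined-unique {w = w} (inj₁ (_ , o)) (inj₂ (e' , o')) =
    ⊥-elim (parity-suc≢ (depth w) (trans (cong (_% 2) (sym (depth-step e'))) (trans o (sym o'))))
  joined-unique {v = v} (inj₂ (e , o)) (inj₁ (_ , o')) =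
    ⊥-elim (parity-suc≢ (depth v) (trans (cong (_% 2) (sym (depth-step e))) (trans o' (sym o))))

onBoard? : ∀ m n u → Dec (OnBoard m n u)
onBoard? m n (x , y) = ((1 ≤? x) ×-dec (x ≤? n)) ×-dec ((1 ≤? y) ×-dec (y ≤? m))

pathPos⇒gkMinus : ∀ {m n u v p} → PathPos m n u v p → GkMinus m n u v
pathPos⇒gkMinus (leftmost e _) = e
pathPos⇒gkMinus (following e _) = e

map-suc≡just : ∀ (x : Maybe ℕ) {t} → Maybe.map suc x ≡ just t → Σ ℕ λ h → x ≡ just h × t ≡ suc h
map-suc≡just (just h) refl = h , refl , refl

Endpoint : Cell → Cell → Cell → Set
Endpoint w u v = w ≡ u ⊎ w ≡ v

endpoints-in-row : ∀ {a a' y u v} → row u ≢ row v → Endpoint (a , y) u v → Endpoint (a' , y) u v → a ≡ a'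
endpoints-in-row _ (inj₁ refl) (inj₁ refl) = refl
endpoints-in-row r≢ (inj₁ refl) (inj₂ refl) = ⊥-elim (r≢ refl)
endpoints-in-row r≢ (inj₂ refl) (inj₁ refl) = ⊥-elim (r≢ refl)
endpoints-in-row _ (inj₂ refl) (inj₂ refl) = refl

endpoints-shareRow : ∀ {a a' y u v u' v'} → Endpoint (a , y) u v → Endpoint (a' , y) u' v' → ShareRow u v u' v'
endpoints-shareRow (inj₁ refl) (inj₁ refl) = inj₁ (inj₁ refl)
endpoints-shareRow (inj₁ refl) (inj₂ refl) = inj₁ (inj₂ refl)
endpoints-shareRow (inj₂ refl) (inj₁ refl) = inj₂ (inj₁ refl)
endpoints-shareRow (inj₂ refl) (inj₂ refl) = inj₂ (inj₂ refl)

-- The colour 2m - 2 edges are the edges of G_k^- leaving a cell of odd depth, so every cell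
-- lies on at most one of them; hatColour u is the colour H gives to that edge.
module Hat (m n : ℕ) (1≤k : 1 ≤ half m) (k<m : half m < m) (H : HatProperColoring m n (n ∸ 1)) where

  open PathProperties m n (half m) 1≤k k<m public

  pathPos : ∀ {u v} → Edge u v → PathPos m n u v (suc (depth u))
  pathPos {u} = bounded (col u) ≤-refl
    where
    bounded : ∀ f {u v} → col u ≤ f → Edge u v → PathPos m n u v (suc (depth u))
    bounded zero x≤0 (((1≤x , _) , _) , _) = ⊥-elim (<⇒≱ 1≤x x≤0)
    bounded (suc f) {u} {v} x≤1+f e with predecessor? (proj₁ e)
    ... | inj₁ (w , e') = subst (PathPos m n u v) (cong suc (sym (depth-step e')))
                            (following e (bounded f (s≤s⁻¹ (≤-trans (edge-col< e') x≤1+f)) e'))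
    ... | inj₂ none = subst (PathPos m n u v) (cong suc (sym (depth-start (proj₁ e) none))) (leftmost e none)

  hatEdge : ∀ {u v} → Edge u v → Odd (depth u) → HatEdge m n u v
  hatEdge {u} e o = suc (depth u) , pathPos e , odd⇒suc-even {depth u} o

  edgeHat : ∀ {u v} → Edge u v → Odd (depth u) → ℕ
  edgeHat {u} {v} e o = toℕ (proj₁ H u v (hatEdge e o))

  edgeHat-irrelevant : ∀ {u v} (e e' : Edge u v) o o' → edgeHat e o ≡ edgeHat e' o'
  edgeHat-irrelevant e e' o o' rewrite edge-irrelevant e e' | ≡-irrelevant o o' = refl

  incomingHat : ∀ {u} → OnBoard m n u → Maybe ℕ
  incomingHat u∈ with predecessor? u∈
  ... | inj₁ (w , e) with odd? (depth w)
  ...   | yes o = just (edgeHat e o)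
  ...   | no _ = nothing
  incomingHat u∈ | inj₂ _ = nothing

  hatColour : Cell → Maybe ℕ
  hatColour u with onBoard? m n u
  ... | no _ = nothing
  ... | yes u∈ with successor? u∈
  ...   | inj₂ _ = incomingHat u∈
  ...   | inj₁ (v , e) with odd? (depth u)
  ...     | yes o = just (edgeHat e o)
  ...     | no _ = incomingHat u∈

  HatAt : Cell → ℕ → Set
  HatAt u h = Σ Cell λ u₀ → Σ Cell λ v₀ → Σ (HatEdge m n u₀ v₀) λ e →
              h ≡ toℕ (proj₁ H u₀ v₀ e) × Endpoint u u₀ v₀

  incomingHat-sound : ∀ {u h} (u∈ : OnBoard m n u) → incomingHat u∈ ≡ just h → HatAt u h
  incomingHat-sound u∈ eq with predecessor? u∈
  ... | inj₁ (w , e) with odd? (depth w)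
  ...   | yes o = w , _ , hatEdge e o , sym (just-injective eq) , inj₂ refl
  incomingHat-sound u∈ () | inj₁ _ | no _
  incomingHat-sound u∈ () | inj₂ _

  hatColour-sound : ∀ u {h} → hatColour u ≡ just h → HatAt u h
  hatColour-sound u eq with onBoard? m n u
  hatColour-sound u () | no _
  ... | yes u∈ with successor? u∈
  ...   | inj₂ _ = incomingHat-sound u∈ eq
  ...   | inj₁ (v , e) with odd? (depth u)
  ...     | yes o = u , v , hatEdge e o , sym (just-injective eq) , inj₁ refl
  ...     | no _ = incomingHat-sound u∈ eq

  hatColour-< : ∀ u {h} → hatColour u ≡ just h → h < n ∸ 1
  hatColour-< u eq with hatColour-sound u eq
  ... | u₀ , v₀ , e , refl , _ = Finₚ.toℕ<n (proj₁ H u₀ v₀ e)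

  incomingHat-edge : ∀ {u v} (e : Edge u v) (o : Odd (depth u)) u∈ → incomingHat {v} u∈ ≡ just (edgeHat e o)
  incomingHat-edge {u} e o u∈ with predecessor? u∈
  ... | inj₂ none = ⊥-elim (none u e)
  ... | inj₁ (w , e') with predecessor-unique e' e
  ...   | refl with odd? (depth w)
  ...     | yes o' = cong just (edgeHat-irrelevant e' e o' o)
  ...     | no ¬o = ⊥-elim (¬o o)

  hatColour-source : ∀ {u v} (e : Edge u v) (o : Odd (depth u)) → hatColour u ≡ just (edgeHat e o)
  hatColour-source {u} {v} e o with onBoard? m n u
  ... | no u∉ = ⊥-elim (u∉ (proj₁ e))
  ... | yes u∈ with successor? u∈
  ...   | inj₂ none = ⊥-elim (none v e)
  ...   | inj₁ (v' , e') with successor-unique e' e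
  ...     | refl with odd? (depth u)
  ...       | yes o' = cong just (edgeHat-irrelevant e' e o' o)
  ...       | no ¬o = ⊥-elim (¬o o)

  hatColour-target : ∀ {u v} (e : Edge u v) (o : Odd (depth u)) → hatColour v ≡ just (edgeHat e o)
  hatColour-target {u} {v} e o with onBoard? m n v
  ... | no v∉ = ⊥-elim (v∉ (proj₁ (proj₂ e)))
  ... | yes v∈ with successor? v∈
  ...   | inj₂ _ = incomingHat-edge e o v∈
  ...   | inj₁ _ with odd? (depth v)
  ...     | yes o' = ⊥-elim (parity-suc≢ (depth u) (trans (cong (_% 2) (sym (depth-step e))) (trans o' (sym o))))
  ...     | no _ = incomingHat-edge e o v∈

  hatColour-row-injective : ∀ {a a' y h} → hatColour (a , y) ≡ just h → hatColour (a' , y) ≡ just h → a ≡ a'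
  hatColour-row-injective {a} {a'} {y} c c' with hatColour-sound (a , y) c | hatColour-sound (a' , y) c'
  ... | u₀ , v₀ , e , h≡ , at | u₁ , v₁ , e' , h≡' , at'
    with ≡-dec _≟_ _≟_ u₀ u₁ ×-dec ≡-dec _≟_ _≟_ v₀ v₁
  ...   | yes (refl , refl) = endpoints-in-row (edge-row≢ (pathPos⇒gkMinus (proj₁ (proj₂ e)))) at at'
  ...   | no distinct =
    ⊥-elim (proj₂ H u₀ v₀ u₁ v₁ e e' distinct (endpoints-shareRow at at') (Finₚ.toℕ-injective (trans (sym h≡) h≡')))

-- Bishop colours, column colours, and the colours shared by the rows and the hat edges.
data Colour : Set where
  diagonal vertical shared : ℕ → Colour

module Palette (D V S : ℕ) where

  index : Colour → ℕ
  index (diagonal c) = c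
  index (vertical c) = D + c
  index (shared c) = D + V + c

  Bounded : Colour → Set
  Bounded (diagonal c) = c < D
  Bounded (vertical c) = c < V
  Bounded (shared c) = c < S

  index-< : ∀ c → Bounded c → index c < D + V + S
  index-< (diagonal c) c<D = ≤-trans c<D (≤-trans (m≤m+n D V) (m≤m+n (D + V) S))
  index-< (vertical c) c<V = ≤-trans (+-monoʳ-< D c<V) (m≤m+n (D + V) S)
  index-< (shared c) c<S = +-monoʳ-< (D + V) c<S

  private
    below : ∀ {a b} k → a < b → a ≢ b + k
    below k a<b refl = <⇒≱ a<b (m≤m+n _ k)

    vertical≢shared : ∀ {c c'} → c < V → D + c ≢ D + V + c'
    vertical≢shared {c} {c'} c<V e = below c' c<V (+-cancelˡ-≡ D c (V + c') (trans e (+-assoc D V c')))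

  index-injective : ∀ c c' → Bounded c → Bounded c' → index c ≡ index c' → c ≡ c'
  index-injective (diagonal c) (diagonal _) _ _ refl = refl
  index-injective (vertical c) (vertical c') _ _ e = cong vertical (+-cancelˡ-≡ D c c' e)
  index-injective (shared c) (shared c') _ _ e = cong shared (+-cancelˡ-≡ (D + V) c c' e)
  index-injective (diagonal c) (vertical c') c<D _ e = ⊥-elim (below c' c<D e)
  index-injective (vertical c) (diagonal c') _ c'<D e = ⊥-elim (below c c'<D (sym e))
  index-injective (diagonal c) (shared c') c<D _ e = ⊥-elim (below c' (≤-trans c<D (m≤m+n D V)) e)
  index-injective (shared c) (diagonal c') _ c'<D e = ⊥-elim (below c (≤-trans c'<D (m≤m+n D V)) (sym e))
  index-injective (vertical c) (shared c') c<V _ e = ⊥-elim (vertical≢shared c<V e)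
  index-injective (shared c) (vertical c') _ c'<V e = ⊥-elim (vertical≢shared c'<V (sym e))

data Family : Set where
  plus minus : Family

bit : Family → ℕ
bit plus = 0
bit minus = 1

bit-< : ∀ f → bit f < 2
bit-< plus = s≤s z≤n
bit-< minus = s≤s (s≤s z≤n)

bit-injective : ∀ {f f'} → bit f ≡ bit f' → f ≡ f'
bit-injective {plus} {plus} _ = refl
bit-injective {minus} {minus} _ = refl

-- The canonical colouring, 0-based: G_i^f owns the pair (code i f 0 , code i f 1), and an edge
-- whose left endpoint has depth parity p gets code i f p; the hat colour is code k minus 1.
code : ℕ → Family → ℕ → ℕ
code i f p = p + (bit f + (i ∸ 1) * 2) * 2

code-injective : ∀ {i i' f f' p p'} → 1 ≤ i → 1 ≤ i' → p < 2 → p' < 2 →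
                 code i f p ≡ code i' f' p' → i ≡ i' × f ≡ f' × p ≡ p'
code-injective {suc _} {suc _} {f} {f'} _ _ p<2 p'<2 e
  with digits-injective p<2 p'<2 e
... | p≡p' , e' with digits-injective (bit-< f) (bit-< f') e'
...   | b≡b' , i∸1≡i'∸1 = cong suc i∸1≡i'∸1 , bit-injective b≡b' , p≡p'

code-≤ : ∀ {i k f p} → i ≤ k → p < 2 → code i f p ≤ code k minus 1
code-≤ {i} {k} {f} i≤k (s≤s p≤1) =
  +-mono-≤ p≤1 (*-monoˡ-≤ 2 (+-mono-≤ (s≤s⁻¹ (bit-< f)) (*-monoˡ-≤ 2 (∸-monoˡ-≤ 1 i≤k))))

code-< : ∀ {i k f p} → 1 ≤ i → i ≤ k → p < 2 → ¬ (i ≡ k × f ≡ minus × p ≡ 1) → code i f p < code k minus 1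
code-< {f = f} 1≤i i≤k p<2 not-top =
  ≤∧≢⇒< (code-≤ {f = f} i≤k p<2)
        (λ e → not-top (code-injective 1≤i (≤-trans 1≤i i≤k) p<2 (s≤s (s≤s z≤n)) e))

-- Mirroring the rows turns G_i^+ into G_i^-.
mirror : ℕ → Cell → Cell
mirror m (x , y) = x , suc m ∸ y

orient : ℕ → Family → Cell → Cell
orient m plus = mirror m
orient m minus u = u

orient-onBoard : ∀ {m n} f {u} → OnBoard m n u → OnBoard m n (orient m f u)
orient-onBoard plus (x∈ , (1≤y , y≤m)) = x∈ , (m<n⇒0<n∸m (s≤s y≤m) , ∸-monoʳ-≤ _ 1≤y)
orient-onBoard minus u∈ = u∈

orient-injective : ∀ {m n} f {u v} → OnBoard m n u → OnBoard m n v → orient m f u ≡ orient m f v → u ≡ v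
orient-injective plus (_ , (_ , y≤m)) (_ , (_ , y'≤m)) e =
  cong₂ _,_ (cong col e) (∸-cancelˡ-≡ (m≤n⇒m≤1+n y≤m) (m≤n⇒m≤1+n y'≤m) (cong row e))
orient-injective minus _ _ e = e

reflect-shift : ∀ {m} a d → a + d ≤ m → suc m ∸ a ≡ (suc m ∸ (a + d)) + d
reflect-shift {m} a d a+d≤m = begin
  suc m ∸ a                 ≡⟨ m∸n+n≡m d≤ ⟨
  (suc m ∸ a) ∸ d + d       ≡⟨ cong (_+ d) (∸-+-assoc (suc m) a d) ⟩
  (suc m ∸ (a + d)) + d     ∎
  where
  open ≡-Reasoning
  d≤ : d ≤ suc m ∸ a
  d≤ = m+n≤o⇒m≤o∸n d (subst (_≤ suc m) (+-comm a d) (m≤n⇒m≤1+n a+d≤m))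

mirror-pos : ∀ {m d u v} → PosEdge d u v → row v ≤ m → NegEdge d (mirror m u) (mirror m v)
mirror-pos {d = d} {_ , y} (x≡ , refl) y+d≤m = x≡ , reflect-shift y d y+d≤m

mirror-neg : ∀ {m d u v} → NegEdge d u v → row u ≤ m → PosEdge d (mirror m u) (mirror m v)
mirror-neg {d = d} {v = _ , y} (x≡ , refl) y+d≤m = x≡ , reflect-shift y d y+d≤m

shift-diagonal : ∀ {xL xR a b} → xL ≤ xR → xL + a ≡ xR + b → a ≡ b + (xR ∸ xL)
shift-diagonal {xL} {xR} {a} {b} xL≤xR e = +-cancelˡ-≡ xL a _ (begin
  xL + a                  ≡⟨ e ⟩
  xR + b                  ≡⟨ cong (_+ b) (m+[n∸m]≡n xL≤xR) ⟨
  xL + (xR ∸ xL) + b      ≡⟨ +-assoc xL _ b ⟩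
  xL + ((xR ∸ xL) + b)    ≡⟨ cong (xL +_) (+-comm _ b) ⟩
  xL + (b + (xR ∸ xL))    ∎)
  where open ≡-Reasoning

diagonal-edge : ∀ {xL yL xR yR} → xL < xR → (xL + yR ≡ xR + yL ⊎ xL + yL ≡ xR + yR) →
                PosEdge (xR ∸ xL) (xL , yL) (xR , yR) ⊎ NegEdge (xR ∸ xL) (xL , yL) (xR , yR)
diagonal-edge xL<xR (inj₁ e) = inj₁ (sym (m+[n∸m]≡n (<⇒≤ xL<xR)) , shift-diagonal (<⇒≤ xL<xR) e)
diagonal-edge xL<xR (inj₂ e) = inj₂ (sym (m+[n∸m]≡n (<⇒≤ xL<xR)) , shift-diagonal (<⇒≤ xL<xR) e)

pred-< : ∀ {a N} → 1 ≤ a → a ≤ N → a ∸ 1 < N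
pred-< {suc _} _ a≤N = a≤N

diagonal-injective : ∀ {a b} → diagonal a ≡ diagonal b → a ≡ b
diagonal-injective refl = refl

vertical-injective : ∀ {a b} → vertical a ≡ vertical b → a ≡ b
vertical-injective refl = refl

shared-injective : ∀ {a b} → shared a ≡ shared b → a ≡ b
shared-injective refl = refl

module QueenColouring (m n t : ℕ) (m≡1+2k : m ≡ suc (half m + half m)) (n≡1+2t : n ≡ suc (t + t))
                      (1≤k : 1 ≤ half m) (m≤n : m ≤ n) (H : HatProperColoring m n (n ∸ 1)) where

  k : ℕ
  k = half m

  k<m : k < m
  k<m = subst (k <_) (sym m≡1+2k) (s≤s (m≤m+n k k))

  open Hat m n 1≤k k<m H

  module Columns = OddComplete k
  module Rows = OddComplete t

  D : ℕ
  D = code k minus 1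

  open Palette D m (n ∸ 1)

  columnColour : Cell → Cell → ℕ
  columnColour u v = Columns.edgeColour (row u ∸ 1) (row v ∸ 1)

  -- Row y is coloured as the complete graph on its n cells, with the colours relabelled by
  -- the injection rowPermutation y so that the colour missing at (a + 1 , y) becomes 1 + the
  -- hat colour there; the relabelled colour 0 is the column colour y - 1, which no column
  -- edge at row y uses.
  rowTarget : ℕ → ℕ → Maybe ℕ
  rowTarget y a = Maybe.map suc (hatColour (suc a , y))

  rowPermutation : ℕ → ℕ → ℕ
  rowPermutation y = Extension.extend (rowTarget y) n

  rowColour : ℕ → ℕ → Colour
  rowColour y zero = vertical (y ∸ 1)
  rowColour y (suc j) = shared j

  rowEdgeColour : Cell → Cell → Colour
  rowEdgeColour u v = rowColour (row u) (rowPermutation (row u) (Rows.edgeColour (col u ∸ 1) (col v ∸ 1)))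

  depthParity : ℕ → Family → Cell → ℕ
  depthParity i f L = Paths.depth m n i (orient m f L) % 2

  -- The default 0 is never used: on an edge of G_k^- leaving a cell of odd depth, hatColour is just.
  familyColour : ℕ → Family → Cell → Colour
  familyColour i plus L = diagonal (code i plus (depthParity i plus L))
  familyColour i minus L with i ≟ k
  ... | no _ = diagonal (code i minus (depthParity i minus L))
  ... | yes _ with odd? (depth L)
  ...   | yes _ = shared (Maybe.fromMaybe 0 (hatColour L))
  ...   | no _ = diagonal (code i minus (depthParity i minus L))

  -- A diagonal edge of length d lies in G_d^- or G_(m-d)^+ if its slope is positive,
  -- and in G_d^+ or G_(m-d)^- otherwise, according to whether d ≤ k.
  familyOf : Cell → Cell → ℕ × Family
  familyOf L R with row L <? row R | col R ∸ col L ≤? k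
  ... | yes _ | yes _ = col R ∸ col L , minus
  ... | yes _ | no _ = m ∸ (col R ∸ col L) , plus
  ... | no _ | yes _ = col R ∸ col L , plus
  ... | no _ | no _ = m ∸ (col R ∸ col L) , minus

  bishopColour : Cell → Cell → Colour
  bishopColour L R = familyColour (proj₁ (familyOf L R)) (proj₂ (familyOf L R)) L

  qColour : Cell → Cell → Colour
  qColour u v with row u ≟ row v
  ... | yes _ = rowEdgeColour u v
  ... | no _ with col u ≟ col v
  ...   | yes _ = vertical (columnColour u v)
  ...   | no _ with col u <? col v
  ...     | yes _ = bishopColour u v
  ...     | no _ = bishopColour v u

  data FamilyEdge (i : ℕ) (f : Family) (L R : Cell) : Set where
    familyEdge : 1 ≤ i → i ≤ k → Paths.Edge m n i (orient m f L) (orient m f R) → FamilyEdge i f L R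

  complement-bounds : ∀ {d} → k < d → d < m → 1 ≤ m ∸ d × m ∸ d ≤ k
  complement-bounds {d} k<d d<m =
    m<n⇒0<n∸m d<m , m≤n+o⇒m∸n≤o m d (subst (_≤ d + k) (sym m≡1+2k) (+-monoˡ-≤ k k<d))

  length-< : ∀ {d y y'} → 1 ≤ y → y' ≡ y + d → y' ≤ m → d < m
  length-< {d} 1≤y refl y'≤m = ≤-trans (m<n+m d 1≤y) y'≤m

  complement-edge : ∀ {d L R} f → k < d → d < m → OnBoard m n (orient m f L) → OnBoard m n (orient m f R) →
                    NegEdge d (orient m f L) (orient m f R) → FamilyEdge (m ∸ d) f L R
  complement-edge {d} f k<d d<m L∈ R∈ neg = familyEdge (proj₁ bounds) (proj₂ bounds) (L∈ , R∈ ,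
    inj₂ (subst (λ e → NegEdge e _ _) (sym (m∸[m∸n]≡n (<⇒≤ d<m))) neg))
    where
    bounds : 1 ≤ m ∸ d × m ∸ d ≤ k
    bounds = complement-bounds k<d d<m

  familyOf-edge : ∀ {L R} → OnBoard m n L → OnBoard m n R → col L < col R →
                  (col L + row R ≡ col R + row L ⊎ col L + row L ≡ col R + row R) →
                  FamilyEdge (proj₁ (familyOf L R)) (proj₂ (familyOf L R)) L R
  familyOf-edge {xL , yL} {xR , yR} L∈@(_ , (1≤yL , yL≤m)) R∈@(_ , (1≤yR , yR≤m)) xL<xR on-diagonal
    with yL <? yR | xR ∸ xL ≤? k | diagonal-edge xL<xR on-diagonal
  ... | yes _ | yes d≤k | inj₁ pos = familyEdge (m<n⇒0<n∸m xL<xR) d≤k (L∈ , R∈ , inj₁ pos)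
  ... | yes _ | no d≰k | inj₁ pos@(_ , yR≡) =
    complement-edge {L = xL , yL} {xR , yR} plus (≰⇒> d≰k) (length-< 1≤yL yR≡ yR≤m)
      (orient-onBoard plus L∈) (orient-onBoard plus R∈) (mirror-pos pos yR≤m)
  ... | yes yL<yR | _ | inj₂ (_ , yL≡) = ⊥-elim (<⇒≱ yL<yR (subst (yR ≤_) (sym yL≡) (m≤m+n yR _)))
  ... | no yL≮yR | _ | inj₁ (_ , yR≡) = ⊥-elim (yL≮yR (subst (yL <_) (sym yR≡) (m<m+n yL (m<n⇒0<n∸m xL<xR))))
  ... | no _ | yes d≤k | inj₂ neg =
    familyEdge (m<n⇒0<n∸m xL<xR) d≤k (orient-onBoard plus L∈ , orient-onBoard plus R∈ , inj₁ (mirror-neg neg yL≤m))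
  ... | no _ | no d≰k | inj₂ neg@(_ , yL≡) =
    complement-edge minus (≰⇒> d≰k) (length-< 1≤yR yL≡ yL≤m) L∈ R∈ neg

  depthParity-< : ∀ i f L → depthParity i f L < 2
  depthParity-< i f L = m%n<n (Paths.depth m n i (orient m f L)) 2

  data Diagonal (L R : Cell) (c : Colour) : Set where
    family : ∀ i f → 1 ≤ i → i ≤ k → Paths.Edge m n i (orient m f L) (orient m f R) →
             code i f (depthParity i f L) < D → c ≡ diagonal (code i f (depthParity i f L)) → Diagonal L R c
    hat : (e : Edge L R) (o : Odd (depth L)) → c ≡ shared (edgeHat e o) → Diagonal L R c

  familyEdge-diagonal : ∀ {i f L R} → FamilyEdge i f L R → Diagonal L R (familyColour i f L)
  familyEdge-diagonal {i} {plus} {L} (familyEdge 1≤i i≤k e) =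
    family i plus 1≤i i≤k e (code-< {f = plus} 1≤i i≤k (depthParity-< i plus L) λ { (_ , () , _) }) refl
  familyEdge-diagonal {i} {minus} {L} (familyEdge 1≤i i≤k e) with i ≟ k
  ... | no i≢k =
    family i minus 1≤i i≤k e (code-< {f = minus} 1≤i i≤k (depthParity-< i minus L) λ (i≡k , _) → i≢k i≡k) refl
  ... | yes refl with odd? (depth L)
  ...   | yes o = hat e o (cong (shared ∘ Maybe.fromMaybe 0) (hatColour-source e o))
  ...   | no ¬o =
    family k minus 1≤i i≤k e (code-< {f = minus} 1≤i i≤k (depthParity-< k minus L) λ (_ , _ , o) → ¬o o) refl

  data Kind (u v : Cell) (c : Colour) : Set where
    inFamily : ∀ i f p → 1 ≤ i → i ≤ k → Paths.Joined m n i p (orient m f u) (orient m f v) →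
               code i f p < D → c ≡ diagonal (code i f p) → Kind u v c
    onHat : ∀ h → hatColour u ≡ just h → Joined 1 u v → c ≡ shared h → Kind u v c
    inColumn : col u ≡ col v → row u ≢ row v → c ≡ vertical (columnColour u v) → Kind u v c
    inRow : row u ≡ row v → col u ≢ col v → c ≡ rowEdgeColour u v → Kind u v c

  diagonal-kindˡ : ∀ {L R c} → Diagonal L R c → Kind L R c
  diagonal-kindˡ (family i f 1≤i i≤k e bound eq) = inFamily i f _ 1≤i i≤k (inj₁ (e , refl)) bound eq
  diagonal-kindˡ (hat e o eq) = onHat _ (hatColour-source e o) (inj₁ (e , o)) eq

  diagonal-kindʳ : ∀ {L R c} → Diagonal L R c → Kind R L c
  diagonal-kindʳ (family i f 1≤i i≤k e bound eq) = inFamily i f _ 1≤i i≤k (inj₂ (e , refl)) bound eq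
  diagonal-kindʳ (hat e o eq) = onHat _ (hatColour-target e o) (inj₂ (e , o)) eq

  kind : ∀ {u v} → QAdj m n u v → Kind u v (qColour u v)
  kind {x , y} {x' , y'} (u∈ , v∈ , u≢v , lines) with y ≟ y'
  ... | yes y≡y' = inRow y≡y' (λ x≡x' → u≢v (cong₂ _,_ x≡x' y≡y')) refl
  ... | no y≢y' with x ≟ x'
  ...   | yes x≡x' = inColumn x≡x' y≢y' refl
  ...   | no x≢x' with lines
  ...     | inj₁ (inj₁ y≡y') = ⊥-elim (y≢y' y≡y')
  ...     | inj₁ (inj₂ x≡x') = ⊥-elim (x≢x' x≡x')
  ...     | inj₂ on-diagonal with x <? x'
  ...       | yes x<x' = diagonal-kindˡ (familyEdge-diagonal (familyOf-edge u∈ v∈ x<x' on-diagonal))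
  ...       | no x≮x' = diagonal-kindʳ (familyEdge-diagonal
    (familyOf-edge v∈ u∈ (≤∧≢⇒< (≮⇒≥ x≮x') (≢-sym x≢x')) (Sum.map sym sym on-diagonal)))

  suc[n∸1]≡n : suc (n ∸ 1) ≡ n
  suc[n∸1]≡n = trans (cong (λ z → suc (z ∸ 1)) n≡1+2t) (sym n≡1+2t)

  rowTarget-injective : ∀ y {a a' t} → rowTarget y a ≡ just t → rowTarget y a' ≡ just t → a ≡ a'
  rowTarget-injective y {a} {a'} e e' with map-suc≡just (hatColour (suc a , y)) e | map-suc≡just (hatColour (suc a' , y)) e'
  ... | h , c , refl | h' , c' , h≡h' rewrite suc-injective h≡h' = suc-injective (hatColour-row-injective c c')

  rowTarget-< : ∀ y {a t} → rowTarget y a ≡ just t → t < n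
  rowTarget-< y {a} e with map-suc≡just (hatColour (suc a , y)) e
  ... | h , c , refl = subst (suc (suc h) ≤_) suc[n∸1]≡n (s≤s (hatColour-< (suc a , y) c))

  rowPermutation-injective : ∀ y {a b} → rowPermutation y a ≡ rowPermutation y b → a ≡ b
  rowPermutation-injective y = Extension.extend-injective (rowTarget y) n

  rowPermutation-< : ∀ y {a} → a < n → rowPermutation y a < n
  rowPermutation-< y = Extension.extend-< (rowTarget y) (rowTarget-< y) ≤-refl

  rowPermutation-hat : ∀ {x y h} → 1 ≤ x → x ≤ n → hatColour (x , y) ≡ just h → rowPermutation y (x ∸ 1) ≡ suc h
  rowPermutation-hat {suc x} {y} _ x<n c =
    Extension.extend-target (rowTarget y) (rowTarget-injective y) x<n (cong (Maybe.map suc) c)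

  rowColour-injective : ∀ y {z z'} → rowColour y z ≡ rowColour y z' → z ≡ z'
  rowColour-injective y {zero} {zero} _ = refl
  rowColour-injective y {suc _} {suc _} e = cong suc (shared-injective e)

  rowColour≡vertical : ∀ {y c} z → rowColour y z ≡ vertical c → y ∸ 1 ≡ c
  rowColour≡vertical zero refl = refl

  rowColour≡shared : ∀ {y h} z → rowColour y z ≡ shared h → z ≡ suc h
  rowColour≡shared (suc _) refl = refl

  rowColour≢diagonal : ∀ {y c} z → rowColour y z ≢ diagonal c
  rowColour≢diagonal zero ()
  rowColour≢diagonal (suc _) ()

  rowIndex-< : ∀ {u} → OnBoard m n u → row u ∸ 1 < Columns.N
  rowIndex-< {_ , y} (_ , (1≤y , y≤m)) = subst (y ∸ 1 <_) m≡1+2k (pred-< 1≤y y≤m)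

  colIndex-< : ∀ {u} → OnBoard m n u → col u ∸ 1 < Rows.N
  colIndex-< {x , _} ((1≤x , x≤n) , _) = subst (x ∸ 1 <_) n≡1+2t (pred-< 1≤x x≤n)

  row-injective : ∀ {u v} → OnBoard m n u → OnBoard m n v → row u ∸ 1 ≡ row v ∸ 1 → row u ≡ row v
  row-injective (_ , (1≤y , _)) (_ , (1≤y' , _)) = pred-injective ⦃ >-nonZero 1≤y ⦄ ⦃ >-nonZero 1≤y' ⦄

  col-injective : ∀ {u v} → OnBoard m n u → OnBoard m n v → col u ∸ 1 ≡ col v ∸ 1 → col u ≡ col v
  col-injective ((1≤x , _) , _) ((1≤x' , _) , _) = pred-injective ⦃ >-nonZero 1≤x ⦄ ⦃ >-nonZero 1≤x' ⦄

  column-unique : ∀ {u v w} → OnBoard m n v → OnBoard m n w → col u ≡ col v → col u ≡ col w →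
                  columnColour u v ≡ columnColour u w → v ≡ w
  column-unique {u} v∈ w∈ refl refl e =
    cong (col u ,_) (row-injective v∈ w∈ (Columns.edgeColour-injectiveʳ (row u ∸ 1) (rowIndex-< v∈) (rowIndex-< w∈) e))

  column≢row : ∀ {u v w} → OnBoard m n u → OnBoard m n v → row u ≢ row v →
               vertical (columnColour u v) ≢ rowEdgeColour u w
  column≢row u∈ v∈ y≢y' e =
    y≢y' (row-injective u∈ v∈
      (Columns.edgeColour-missing (rowIndex-< u∈) (rowIndex-< v∈) (sym (rowColour≡vertical _ (sym e)))))

  row-unique : ∀ {u v w} → OnBoard m n v → OnBoard m n w → row u ≡ row v → row u ≡ row w →
               rowEdgeColour u v ≡ rowEdgeColour u w → v ≡ w
  row-unique {u} v∈ w∈ refl refl e = cong (_, row u) (col-injective v∈ w∈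
    (Rows.edgeColour-injectiveʳ (col u ∸ 1) (colIndex-< v∈) (colIndex-< w∈)
      (rowPermutation-injective (row u) (rowColour-injective (row u) e))))

  hat≢row : ∀ {u v h} → OnBoard m n u → OnBoard m n v → col u ≢ col v → hatColour u ≡ just h →
            shared h ≢ rowEdgeColour u v
  hat≢row {u@(_ , y)} {v} u∈@((1≤x , x≤n) , _) v∈ x≢x' c e = x≢x' (col-injective u∈ v∈
    (Rows.edgeColour-missing (colIndex-< u∈) (colIndex-< v∈) (rowPermutation-injective y
      (trans (rowColour≡shared _ (sym e)) (sym (rowPermutation-hat 1≤x x≤n c))))))

  family-unique : ∀ {i i' f f' p p' u v w} → OnBoard m n v → OnBoard m n w → 1 ≤ i → i ≤ k → 1 ≤ i' →
                  Paths.Joined m n i p (orient m f u) (orient m f v) →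
                  Paths.Joined m n i' p' (orient m f' u) (orient m f' w) →
                  code i f p ≡ code i' f' p' → v ≡ w
  family-unique {i} {i'} {f} {f'} {p} {p'} v∈ w∈ 1≤i i≤k 1≤i' joined joined' e
    with code-injective {i} {i'} {f} {f'} {p} {p'} 1≤i 1≤i'
           (Paths.joined-parity-< m n i joined) (Paths.joined-parity-< m n i' joined') e
  ... | refl , refl , refl =
    orient-injective f v∈ w∈ (PathProperties.joined-unique m n i 1≤i (≤-<-trans i≤k k<m) joined joined')

  kind-unique : ∀ {u v w c} → OnBoard m n u → OnBoard m n v → OnBoard m n w → Kind u v c → Kind u w c → v ≡ w
  kind-unique {u} {v} {w} _ v∈ w∈ (inFamily i f p 1≤i i≤k j _ refl) (inFamily i' f' p' 1≤i' _ j' _ e) =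
    family-unique {i} {i'} {f} {f'} {p} {p'} {u} v∈ w∈ 1≤i i≤k 1≤i' j j' (diagonal-injective e)
  kind-unique _ _ _ (inFamily _ _ _ _ _ _ _ refl) (onHat _ _ _ ())
  kind-unique _ _ _ (inFamily _ _ _ _ _ _ _ refl) (inColumn _ _ ())
  kind-unique _ _ _ (inFamily _ _ _ _ _ _ _ refl) (inRow _ _ e) = ⊥-elim (rowColour≢diagonal _ (sym e))
  kind-unique _ _ _ (onHat _ _ _ refl) (inFamily _ _ _ _ _ _ _ ())
  kind-unique _ _ _ (onHat _ _ j _) (onHat _ _ j' _) = joined-unique j j'
  kind-unique _ _ _ (onHat _ _ _ refl) (inColumn _ _ ())
  kind-unique {u} {_} {w} u∈ _ w∈ (onHat _ c _ refl) (inRow _ x≢x' e) = ⊥-elim (hat≢row {u} {w} u∈ w∈ x≢x' c e)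
  kind-unique _ _ _ (inColumn _ _ refl) (inFamily _ _ _ _ _ _ _ ())
  kind-unique _ _ _ (inColumn _ _ refl) (onHat _ _ _ ())
  kind-unique {u} {v} {w} _ v∈ w∈ (inColumn x≡ _ refl) (inColumn x≡' _ e) =
    column-unique {u} {v} {w} v∈ w∈ x≡ x≡' (vertical-injective e)
  kind-unique {u} {v} {w} u∈ v∈ _ (inColumn _ y≢y' refl) (inRow _ _ e) = ⊥-elim (column≢row {u} {v} {w} u∈ v∈ y≢y' e)
  kind-unique _ _ _ (inRow _ _ e) (inFamily _ _ _ _ _ _ _ refl) = ⊥-elim (rowColour≢diagonal _ (sym e))
  kind-unique {u} {v} u∈ v∈ _ (inRow _ x≢x' e) (onHat _ c _ refl) = ⊥-elim (hat≢row {u} {v} u∈ v∈ x≢x' c e)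
  kind-unique {u} {v} {w} u∈ _ w∈ (inRow _ _ e) (inColumn _ y≢y' refl) = ⊥-elim (column≢row {u} {w} {v} u∈ w∈ y≢y' e)
  kind-unique {u} {v} {w} _ v∈ w∈ (inRow y≡ _ refl) (inRow y≡' _ e) = row-unique {u} {v} {w} v∈ w∈ y≡ y≡' e

  kind-bounded : ∀ {u v c} → OnBoard m n u → OnBoard m n v → Kind u v c → Bounded c
  kind-bounded _ _ (inFamily _ _ _ _ _ _ bound refl) = bound
  kind-bounded {u} _ _ (onHat _ c _ refl) = hatColour-< u c
  kind-bounded {u} {v} _ _ (inColumn _ _ refl) =
    subst (columnColour u v <_) (sym m≡1+2k) (Columns.edgeColour-< (row u ∸ 1) (row v ∸ 1))
  kind-bounded {x , y} {v} (_ , (1≤y , y≤m)) _ (inRow _ _ refl) = rowColour-bounded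
    (rowPermutation-< y (subst (Rows.edgeColour (x ∸ 1) (col v ∸ 1) <_) (sym n≡1+2t)
                               (Rows.edgeColour-< (x ∸ 1) (col v ∸ 1))))
    where
    rowColour-bounded : ∀ {z} → z < n → Bounded (rowColour y z)
    rowColour-bounded {zero} _ = pred-< 1≤y y≤m
    rowColour-bounded {suc _} z<n = s≤s⁻¹ (subst (_ ≤_) (sym suc[n∸1]≡n) z<n)

  qColour-comm : ∀ u v → qColour u v ≡ qColour v u
  qColour-comm (x , y) (x' , y') with y ≟ y' | y' ≟ y
  ... | yes refl | yes _ = cong (λ c → rowColour y (rowPermutation y c)) (Rows.edgeColour-comm (x ∸ 1) (x' ∸ 1))
  ... | yes y≡y' | no y'≢y = ⊥-elim (y'≢y (sym y≡y'))
  ... | no y≢y' | yes y'≡y = ⊥-elim (y≢y' (sym y'≡y))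
  ... | no _ | no _ with x ≟ x' | x' ≟ x
  ...   | yes refl | yes _ = cong vertical (Columns.edgeColour-comm (y ∸ 1) (y' ∸ 1))
  ...   | yes x≡x' | no x'≢x = ⊥-elim (x'≢x (sym x≡x'))
  ...   | no x≢x' | yes x'≡x = ⊥-elim (x≢x' (sym x'≡x))
  ...   | no x≢x' | no _ with x <? x' | x' <? x
  ...     | yes x<x' | yes x'<x = ⊥-elim (<-asym x<x' x'<x)
  ...     | yes _ | no _ = refl
  ...     | no _ | yes _ = refl
  ...     | no x≮x' | no x'≮x = ⊥-elim (x≢x' (≤-antisym (≮⇒≥ x'≮x) (≮⇒≥ x≮x')))

  colourable : QEdgeColorable m n (D + m + (n ∸ 1))
  colourable = colouring , colouring-comm , colouring-proper
    where
    qAdj-source : ∀ {u v} → QAdj m n u v → OnBoard m n u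
    qAdj-source {_ , _} {_ , _} = proj₁
    qAdj-target : ∀ {u v} → QAdj m n u v → OnBoard m n v
    qAdj-target {_ , _} {_ , _} = proj₁ ∘ proj₂
    colour-< : ∀ {u v} (a : QAdj m n u v) → index (qColour u v) < D + m + (n ∸ 1)
    colour-< {u} {v} a = index-< (qColour u v) (kind-bounded (qAdj-source a) (qAdj-target a) (kind a))
    colouring : (u v : Cell) → QAdj m n u v → Fin (D + m + (n ∸ 1))
    colouring u v a = fromℕ< (colour-< a)
    colouring-comm : ∀ u v (a : QAdj m n u v) (a' : QAdj m n v u) → colouring u v a ≡ colouring v u a'
    colouring-comm u v a a' = Finₚ.fromℕ<-cong _ _ (cong index (qColour-comm u v)) (colour-< a) (colour-< a')
    colouring-proper : ∀ u v w (a : QAdj m n u v) (a' : QAdj m n u w) → colouring u v a ≡ colouring u w a' → v ≡ w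
    colouring-proper u v w a a' e = kind-unique (qAdj-source a) (qAdj-target a) (qAdj-target a') (kind a)
      (subst (Kind u w) (sym same-colour) (kind a'))
      where
      same-colour : qColour u v ≡ qColour u w
      same-colour = index-injective _ _ (kind-bounded (qAdj-source a) (qAdj-target a) (kind a))
        (kind-bounded (qAdj-source a') (qAdj-target a') (kind a'))
        (trans (sym (Finₚ.toℕ-fromℕ< (colour-< a))) (trans (cong toℕ e) (Finₚ.toℕ-fromℕ< (colour-< a'))))

++⁺ : ∀ {A : Set} (P : A → Set) {a b} (xs : Vector A a) (ys : Vector A b) → All P xs → All P ys → All P (xs ++ ys)
++⁺ P {a} xs ys all-xs all-ys i with splitAt a i
... | inj₁ i' = all-xs i'
... | inj₂ i' = all-ys i'

++-injective : ∀ {A : Set} {a b} {xs : Vector A a} {ys : Vector A b} → Injective _≡_ _≡_ xs → Injective _≡_ _≡_ ys →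
               (∀ i j → xs i ≢ ys j) → Injective _≡_ _≡_ (xs ++ ys)
++-injective {a = a} {b} xs-inj ys-inj disjoint {i} {j} e with splitAt a i in eq | splitAt a j in eq'
... | inj₁ i' | inj₁ j' =
  trans (sym (Finₚ.splitAt⁻¹-↑ˡ eq)) (trans (cong (_↑ˡ b) (xs-inj e)) (Finₚ.splitAt⁻¹-↑ˡ eq'))
... | inj₂ i' | inj₂ j' =
  trans (sym (Finₚ.splitAt⁻¹-↑ʳ eq)) (trans (cong (a ↑ʳ_) (ys-inj e)) (Finₚ.splitAt⁻¹-↑ʳ eq'))
... | inj₁ i' | inj₂ j' = ⊥-elim (disjoint i' j' e)
... | inj₂ i' | inj₁ j' = ⊥-elim (disjoint j' i' (sym e))

<∸1⇒suc< : ∀ {a M} → a < M ∸ 1 → suc a < M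
<∸1⇒suc< {M = suc _} a<M∸1 = s≤s a<M∸1

module CentreStar (m n k : ℕ) (m≡1+2k : m ≡ suc (k + k)) (m≤n : m ≤ n) where

  skip : ℕ → ℕ
  skip r with r <? k
  ... | yes _ = suc r
  ... | no _ = suc (suc r)

  skip≢centre : ∀ r → skip r ≢ suc k
  skip≢centre r with r <? k
  ... | yes r<k = λ e → <⇒≢ r<k (suc-injective e)
  ... | no r≮k = λ e → r≮k (subst (r <_) (suc-injective e) ≤-refl)

  skip-injective : ∀ {r r'} → skip r ≡ skip r' → r ≡ r'
  skip-injective {r} {r'} e with r <? k | r' <? k
  ... | yes _ | yes _ = suc-injective e
  ... | no _ | no _ = suc-injective (suc-injective e)
  ... | yes r<k | no r'≮k = ⊥-elim (r'≮k (<-trans (n<1+n r') (subst (_< k) (suc-injective e) r<k)))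
  ... | no r≮k | yes r'<k = ⊥-elim (r≮k (<-trans (n<1+n r) (subst (_< k) (suc-injective (sym e)) r'<k)))

  skip-≤ : ∀ {r M} → suc r < M → skip r ≤ M
  skip-≤ {r} sr<M with r <? k
  ... | yes _ = <⇒≤ sr<M
  ... | no _ = sr<M

  1≤skip : ∀ r → 1 ≤ skip r
  1≤skip r with r <? k
  ... | yes _ = s≤s z≤n
  ... | no _ = s≤s z≤n

  skip-toℕ-≤ : ∀ M (r : Fin (M ∸ 1)) → skip (toℕ r) ≤ M
  skip-toℕ-≤ M r = skip-≤ (<∸1⇒suc< (Finₚ.toℕ<n r))

  skip-toℕ-injective : ∀ {P} {r r' : Fin P} → skip (toℕ r) ≡ skip (toℕ r') → r ≡ r'
  skip-toℕ-injective e = Finₚ.toℕ-injective (skip-injective e)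

  1+m≡centre+centre : suc m ≡ suc k + suc k
  1+m≡centre+centre = trans (cong suc m≡1+2k) (cong suc (sym (+-suc k k)))

  reflected : ℕ → ℕ
  reflected s = suc m ∸ s

  reflected≡centre : ∀ {s} → s ≤ m → reflected s ≡ suc k → s ≡ suc k
  reflected≡centre {s} s≤m e = +-cancelˡ-≡ (suc k) s (suc k) (begin
    suc k + s            ≡⟨ +-comm (suc k) s ⟩
    s + suc k            ≡⟨ cong (s +_) e ⟨
    s + (suc m ∸ s)      ≡⟨ m+[n∸m]≡n (m≤n⇒m≤1+n s≤m) ⟩
    suc m                ≡⟨ 1+m≡centre+centre ⟩
    suc k + suc k        ∎)
    where open ≡-Reasoning

  reflected-fixed : ∀ {s} → s ≤ m → s ≡ reflected s → s ≡ suc k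
  reflected-fixed {s} s≤m e with <-cmp s (suc k)
  ... | tri< s<c _ _ = ⊥-elim (<⇒≢ (+-mono-< s<c s<c) s+s≡c+c)
    where s+s≡c+c = trans (cong (s +_) e) (trans (m+[n∸m]≡n (m≤n⇒m≤1+n s≤m)) 1+m≡centre+centre)
  ... | tri≈ _ s≡c _ = s≡c
  ... | tri> _ _ s>c = ⊥-elim (<⇒≢ (+-mono-< s>c s>c) (sym s+s≡c+c))
    where s+s≡c+c = trans (cong (s +_) e) (trans (m+[n∸m]≡n (m≤n⇒m≤1+n s≤m)) 1+m≡centre+centre)

  centre : Cell
  centre = suc k , suc k

  1+k≤m : suc k ≤ m
  1+k≤m = subst (suc k ≤_) (sym m≡1+2k) (s≤s (m≤m+n k k))

  centre-onBoard : OnBoard m n centre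
  centre-onBoard = (s≤s z≤n , ≤-trans 1+k≤m m≤n) , (s≤s z≤n , 1+k≤m)

  inRow : Vector Cell (n ∸ 1)
  inRow r = skip (toℕ r) , suc k

  inColumn onDiagonal onAntidiagonal : Vector Cell (m ∸ 1)
  inColumn r = suc k , skip (toℕ r)
  onDiagonal r = skip (toℕ r) , skip (toℕ r)
  onAntidiagonal r = skip (toℕ r) , reflected (skip (toℕ r))

  neighbours : Vector Cell ((n ∸ 1) + ((m ∸ 1) + ((m ∸ 1) + (m ∸ 1))))
  neighbours = inRow ++ (inColumn ++ (onDiagonal ++ onAntidiagonal))

  neighbours-adjacent : All (QAdj m n centre) neighbours
  neighbours-adjacent =
    ++⁺ Adj inRow _ inRow-adjacent
      (++⁺ Adj inColumn _ inColumn-adjacent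
        (++⁺ Adj onDiagonal onAntidiagonal onDiagonal-adjacent onAntidiagonal-adjacent))
    where
    Adj : Cell → Set
    Adj = QAdj m n centre
    skip∈ : (r : Fin (m ∸ 1)) → 1 ≤ skip (toℕ r) × skip (toℕ r) ≤ m
    skip∈ r = 1≤skip (toℕ r) , skip-toℕ-≤ m r
    off-centre : ∀ {r y} → centre ≢ (skip r , y)
    off-centre {r} e = skip≢centre r (sym (cong col e))
    inRow-adjacent : All Adj inRow
    inRow-adjacent r =
      centre-onBoard , ((1≤skip (toℕ r) , skip-toℕ-≤ n r) , (s≤s z≤n , 1+k≤m)) , off-centre , inj₁ (inj₁ refl)
    inColumn-adjacent : All Adj inColumn
    inColumn-adjacent r = centre-onBoard , ((s≤s z≤n , ≤-trans 1+k≤m m≤n) , skip∈ r) ,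
      (λ e → skip≢centre (toℕ r) (sym (cong row e))) , inj₁ (inj₂ refl)
    onDiagonal-adjacent : All Adj onDiagonal
    onDiagonal-adjacent r = centre-onBoard , ((proj₁ (skip∈ r) , ≤-trans (proj₂ (skip∈ r)) m≤n) , skip∈ r) ,
      off-centre , inj₂ (inj₁ (+-comm (suc k) _))
    onAntidiagonal-adjacent : All Adj onAntidiagonal
    onAntidiagonal-adjacent r = centre-onBoard ,
      ((proj₁ (skip∈ r) , ≤-trans (proj₂ (skip∈ r)) m≤n) ,
       (m<n⇒0<n∸m (s≤s (proj₂ (skip∈ r))) , ∸-monoʳ-≤ (suc m) (proj₁ (skip∈ r)))) ,
      off-centre , inj₂ (inj₂ (trans (sym 1+m≡centre+centre) (sym (m+[n∸m]≡n (m≤n⇒m≤1+n (proj₂ (skip∈ r)))))))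

  neighbours-injective : Injective _≡_ _≡_ neighbours
  neighbours-injective =
    ++-injective (skip-toℕ-injective ∘ cong col)
      (++-injective (skip-toℕ-injective ∘ cong row)
        (++-injective (skip-toℕ-injective ∘ cong col) (skip-toℕ-injective ∘ cong col) diagonal≢antidiagonal)
        column≢rest)
      row≢rest
    where
    diagonal≢antidiagonal : ∀ r r' → onDiagonal r ≢ onAntidiagonal r'
    diagonal≢antidiagonal r r' e = skip≢centre _ (reflected-fixed (skip-toℕ-≤ m r)
      (trans (cong row e) (cong reflected (sym (cong col e)))))
    column≢rest : ∀ r r' → inColumn r ≢ (onDiagonal ++ onAntidiagonal) r'
    column≢rest r = ++⁺ (inColumn r ≢_) onDiagonal onAntidiagonal
      (λ _ e → skip≢centre _ (sym (cong col e))) (λ _ e → skip≢centre _ (sym (cong col e)))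
    row≢rest : ∀ r r' → inRow r ≢ (inColumn ++ (onDiagonal ++ onAntidiagonal)) r'
    row≢rest r = ++⁺ (inRow r ≢_) inColumn (onDiagonal ++ onAntidiagonal)
      (λ _ e → skip≢centre _ (sym (cong row e)))
      (++⁺ (inRow r ≢_) onDiagonal onAntidiagonal
        (λ _ e → skip≢centre _ (sym (cong row e)))
        (λ r' e → skip≢centre _ (reflected≡centre (skip-toℕ-≤ m r') (sym (cong row e)))))

  chromaticIndex-≥ : ∀ d → QEdgeColorable m n d → (n ∸ 1) + ((m ∸ 1) + ((m ∸ 1) + (m ∸ 1))) ≤ d
  chromaticIndex-≥ d (colour , _ , proper) =
    Finₚ.injective⇒≤ {f = λ r → colour centre (neighbours r) (neighbours-adjacent r)}
    (λ e → neighbours-injective (proper centre _ _ (neighbours-adjacent _) (neighbours-adjacent _) e))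

odd⇒1+2half : ∀ {m} → Odd m → m ≡ suc (half m + half m)
odd⇒1+2half {m} odd = begin
  m                       ≡⟨ m≡m%n+[m/n]*n m 2 ⟩
  m % 2 + half m * 2      ≡⟨ cong (_+ half m * 2) odd ⟩
  suc (half m * 2)        ≡⟨ cong suc (*-comm (half m) 2) ⟩
  suc (half m + (half m + 0)) ≡⟨ cong (λ h → suc (half m + h)) (+-identityʳ (half m)) ⟩
  suc (half m + half m)   ∎
  where open ≡-Reasoning

sub-of-sum : ∀ {a b} c → a ≡ c + b → a ∸ c ≡ b
sub-of-sum {b = b} c e = trans (cong (_∸ c) e) (m+n∸m≡n c b)

colour-count : ∀ {m k n} → m ≡ suc (k + k) → 1 ≤ k → 1 ≤ n → code k minus 1 + m + (n ∸ 1) ≡ 3 * m + n ∸ 4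
colour-count {k = suc k} {suc n} refl _ _ = sym (sub-of-sum 4 (identity k n))
  where
  identity : ∀ k n → 3 * suc (suc k + suc k) + suc n ≡ 4 + (1 + (1 + k * 2) * 2 + suc (suc k + suc k) + n)
  identity = solve-∀

degree-count : ∀ {m k n} → m ≡ suc (k + k) → 1 ≤ n → (n ∸ 1) + ((m ∸ 1) + ((m ∸ 1) + (m ∸ 1))) ≡ 3 * m + n ∸ 4
degree-count {k = k} {suc n} refl _ = sym (sub-of-sum 4 (identity k n))
  where
  identity : ∀ k n → 3 * suc (k + k) + suc n ≡ 4 + (n + ((k + k) + ((k + k) + (k + k))))
  identity = solve-∀

proposition8 : (m n : ℕ) → Odd m → Odd n → 3 ≤ m → m ≤ n →
    HatProperColoring m n (n ∸ 1) →
    QChromaticIndex m n (3 * m + n ∸ 4)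
proposition8 m n odd-m odd-n 3≤m m≤n H =
  subst (QEdgeColorable m n) (colour-count {k = half m} m≡1+2k 1≤k 1≤n)
    (QueenColouring.colourable m n (half n) m≡1+2k (odd⇒1+2half odd-n) 1≤k m≤n H) ,
  λ d colourable → subst (_≤ d) (degree-count {k = half m} m≡1+2k 1≤n)
                     (CentreStar.chromaticIndex-≥ m n (half m) m≡1+2k m≤n d colourable)
  where
  m≡1+2k : m ≡ suc (half m + half m)
  m≡1+2k = odd⇒1+2half odd-m
  1≤n : 1 ≤ n
  1≤n = ≤-trans (s≤s z≤n) (≤-trans 3≤m m≤n)
  1≤k : 1 ≤ half m
  1≤k = /-monoˡ-≤ 2 3≤m
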